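{- Let $n\ge 1$ and let $a,b$ be positive integers with $a+b\le 2^n$. Then the following are equivalent: $(a,b)$ is fit in $Q_{n+1}$; $(a+2^n,b)$ is fit in $Q_{n+1}$; $(a,b+2^n)$ is fit in $Q_{n+1}$.
   Context: $Q_N=\{0,1\}^N$ is the hypercube graph (binary strings $x_0\ldots x_{N-1}$, adjacent iff they differ in exactly one digit), with automorphism group $\mathrm{Aut}(Q_N)$. Strings are identified with integers $\sum_i x_i2^{N-1-i}$; for $0\le k\le 2^N$, the initial segment $I_k\subseteq Q_N$ is the set of strings with value $<k$. A pair of positive integers $(a,b)$ with $a+b\le 2^N$ is fit in $Q_N$ if there exist $g_1,g_2\in\mathrm{Aut}(Q_N)$ with $g_1(I_a)\cup g_2(I_b)=I_{a+b}$, and unfit in $Q_N$ otherwise. -}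

module Defs where

open import Data.Bool using (Bool; true; false; if_then_else_; _xor_)
open import Data.Nat using (ℕ; zero; suc; _+_; _^_; _<_)
open import Data.Vec using (Vec; []; _∷_)
open import Data.Product using (Σ; _×_; ∃-syntax)
open import Data.Sum using (_⊎_)
open import Relation.Binary.PropositionalEquality using (_≡_)
open import Function.Bundles using (_⇔_)

Vertex : ℕ → Set
Vertex N = Vec Bool N

-- Integer value Σ_i x_i 2^(N-1-i)  (x_0 is the most significant digit).
val : ∀ {N} → Vertex N → ℕ
val [] = 0
val {suc N} (b ∷ xs) = (if b then 2 ^ N else 0) + val xs

hamming : ∀ {N} → Vertex N → Vertex N → ℕ
hamming [] [] = 0
hamming (x ∷ xs) (y ∷ ys) = (if x xor y then 1 else 0) + hamming xs ys

Adj : ∀ {N} → Vertex N → Vertex N → Set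
Adj x y = hamming x y ≡ 1

record Aut (N : ℕ) : Set where
  field
    to       : Vertex N → Vertex N
    from     : Vertex N → Vertex N
    to-from  : ∀ y → to (from y) ≡ y
    from-to  : ∀ x → from (to x) ≡ x
    adj-pres : ∀ x y → Adj x y ⇔ Adj (to x) (to y)

open Aut public

InI : ∀ {N} → ℕ → Vertex N → Set
InI k x = val x < k

InImage : ∀ {N} → Aut N → ℕ → Vertex N → Set
InImage g k y = ∃[ x ] (InI k x × to g x ≡ y)

Fit : ℕ → ℕ → ℕ → Set
Fit N a b = Σ (Aut N) λ g₁ → Σ (Aut N) λ g₂ →
  ∀ (y : Vertex N) → (InImage g₁ a y ⊎ InImage g₂ b y) ⇔ InI (a + b) y

-- Every automorphism g of Q_N permutes coordinates up to sign: each input coordinate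
-- reappears, possibly negated, as one output coordinate. This needs only adjacency
-- preservation, since g (flip i (flip j x)) is the common neighbour of g (flip i x) and
-- g (flip j x) other than g x.
--
-- Work with f = g⁻¹, for which fitness reads f₁⁻¹(I_a) ∪ f₂⁻¹(I_b) = I_{a+b}. If f₁
-- preserves the first coordinate, conjugating f₁ and precomposing f₂ by the flip of that
-- coordinate turns such a cover of I_{a+b} into one of I_{a+2ⁿ+b}, and back; the way back
-- uses that the two preimages are disjoint, which is a counting fact. So it remains to make
-- f₁ preserve the first coordinate by transposing that coordinate with another one.
-- For (a, b), the output coordinate j carrying the first input coordinate vanishes on I_a,
-- as f₁⁻¹(I_a) lies in the lower half; so the transposition fixes I_a pointwise.
-- For (a + 2ⁿ, b) with a + b < 2ⁿ, the input coordinate k that f₁ moves to the front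
-- satisfies {z | z_k = 0} = f₁⁻¹(lower half) ⊆ I_{a+2ⁿ+b}, and then the transposition maps
-- that segment onto itself. If a + b = 2ⁿ, the identity and the complement of the last n
-- coordinates fit (a, b) directly. The claim for b follows by symmetry.

module Submission where

open import Defs
open import Data.Bool using (Bool; true; false; not; if_then_else_; _xor_)
open import Data.Bool.Properties
  using (not-involutive; not-¬; xor-same; xor-assoc; xor-inverseʳ; xor-identityʳ;
         not-distribˡ-xor; not-distribʳ-xor)
open import Data.Empty using (⊥; ⊥-elim)
open import Data.Fin using (Fin; zero; suc; toℕ; fromℕ<; punchOut; _≟_)
open import Data.Fin.Properties
  using (any?; punchOut-injective; injective⇒≤; toℕ-injective; toℕ-fromℕ<; toℕ<n)
open import Data.Nat using (ℕ; zero; suc; _+_; _∸_; _^_; _≤_; _<_; z≤n; s≤s; s≤s⁻¹; _<?_)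
open import Data.Nat.Properties
  using (+-comm; +-assoc; +-suc; +-identityʳ; suc-injective; ≤-refl; ≤-trans; <-≤-trans; <⇒≱;
         ≮⇒≥; 1+n≰n; m≤m+n; m≤n+m; m+n≮m; m+n∸m≡n; m+[n∸m]≡n; +-cancelˡ-<; +-cancelʳ-<;
         +-monoʳ-<; +-monoʳ-≤; m≤n⇒m<n∨m≡n)
open import Data.Nat.Tactic.RingSolver using (solve-∀)
open import Data.Product using (∃; ∃₂; _×_; _,_; proj₁; proj₂)
open import Data.Sum using (_⊎_; inj₁; inj₂; swap)
open import Data.Sum.Function.Propositional using (_⊎-⇔_)
open import Data.Vec using ([]; _∷_; lookup; replicate; map; _[_]%=_; _[_]≔_)
open import Data.Vec.Properties
  using (updateAt-updateAt; updateAt-id-local; updateAt-commutes; lookup∘updateAt;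
         lookup∘updateAt′; lookup∘update; []≔-idempotent; []≔-lookup; lookup-replicate;
         map-∘; map-cong; map-id)
open import Function using (_∘_; id)
open import Function.Bundles using (_⇔_; mk⇔; Equivalence)
open import Function.Construct.Composition using (_⇔-∘_)
open import Function.Construct.Identity using (⇔-id)
open import Function.Construct.Symmetry using (⇔-sym)
open import Function.Definitions using (Injective)
open import Relation.Nullary using (¬_; Dec; yes; no; contradiction)
open import Relation.Binary.PropositionalEquality
open ≡-Reasoning

zeros ones : ∀ {N} → Vertex N
zeros = replicate _ false
ones = replicate _ true

not-xor-not : ∀ x y → not x xor not y ≡ x xor y
not-xor-not x y = begin
  not x xor not y     ≡⟨ not-distribˡ-xor x (not y) ⟨
  not (x xor not y)   ≡⟨ cong not (not-distribʳ-xor x y) ⟨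
  not (not (x xor y)) ≡⟨ not-involutive _ ⟩
  x xor y             ∎

xor-cancelˡ : ∀ x y → x xor (x xor y) ≡ y
xor-cancelˡ x y = trans (sym (xor-assoc x x y)) (cong (_xor y) (xor-same x))

not-≢-self : ∀ {b} → not b ≢ b
not-≢-self e = not-¬ refl (sym e)

flip : ∀ {N} → Fin N → Vertex N → Vertex N
flip i x = x [ i ]%= not

flip-involutive : ∀ {N} (i : Fin N) x → flip i (flip i x) ≡ x
flip-involutive i x = trans (updateAt-updateAt i x) (updateAt-id-local i x (not-involutive _))

flip-comm : ∀ {N} (i j : Fin N) x → flip i (flip j x) ≡ flip j (flip i x)
flip-comm i j x with i ≟ j
... | yes refl = refl
... | no i≢j   = updateAt-commutes i j i≢j x

lookup-flip : ∀ {N} (i : Fin N) x → lookup (flip i x) i ≡ not (lookup x i)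
lookup-flip i x = lookup∘updateAt i x

lookup-flip-≢ : ∀ {N} {i j : Fin N} → i ≢ j → ∀ x → lookup (flip j x) i ≡ lookup x i
lookup-flip-≢ {i = i} {j} i≢j x = lookup∘updateAt′ i j i≢j x

flip-cancelʳ : ∀ {N} {i j : Fin N} x → flip i x ≡ flip j x → i ≡ j
flip-cancelʳ {i = i} {j} x eq with i ≟ j
... | yes i≡j = i≡j
... | no i≢j  = ⊥-elim (not-≢-self (begin
  not (lookup x i)      ≡⟨ lookup-flip i x ⟨
  lookup (flip i x) i   ≡⟨ cong (λ y → lookup y i) eq ⟩
  lookup (flip j x) i   ≡⟨ lookup-flip-≢ i≢j x ⟩
  lookup x i            ∎))

flip-flip-≢ : ∀ {N} {i j : Fin N} → i ≢ j → ∀ x → flip i (flip j x) ≢ x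
flip-flip-≢ {i = i} {j} i≢j x eq = not-≢-self (begin
  not (lookup x i)               ≡⟨ cong not (lookup-flip-≢ i≢j x) ⟨
  not (lookup (flip j x) i)      ≡⟨ lookup-flip i (flip j x) ⟨
  lookup (flip i (flip j x)) i   ≡⟨ cong (λ u → lookup u i) eq ⟩
  lookup x i                     ∎)

swapHead : ∀ {n} → Fin (suc n) → Vertex (suc n) → Vertex (suc n)
swapHead zero    x        = x
swapHead (suc k) (b ∷ xs) = lookup xs k ∷ (xs [ k ]≔ b)

lookup-swapHead-zero : ∀ {n} (k : Fin (suc n)) x → lookup (swapHead k x) zero ≡ lookup x k
lookup-swapHead-zero zero    x        = refl
lookup-swapHead-zero (suc k) (b ∷ xs) = refl

lookup-swapHead : ∀ {n} (k : Fin (suc n)) x → lookup (swapHead k x) k ≡ lookup x zero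
lookup-swapHead zero    x        = refl
lookup-swapHead (suc k) (b ∷ xs) = lookup∘update k xs b

swapHead-id : ∀ {n} (k : Fin (suc n)) x → lookup x zero ≡ lookup x k → swapHead k x ≡ x
swapHead-id zero    x        _    = refl
swapHead-id (suc k) (b ∷ xs) b≡xₖ =
  cong₂ _∷_ (sym b≡xₖ) (trans (cong (xs [ k ]≔_) b≡xₖ) ([]≔-lookup xs k))

swapHead-involutive : ∀ {n} (k : Fin (suc n)) x → swapHead k (swapHead k x) ≡ x
swapHead-involutive zero    x        = refl
swapHead-involutive (suc k) (b ∷ xs) =
  cong₂ _∷_ (lookup∘update k xs b) (trans ([]≔-idempotent xs k) ([]≔-lookup xs k))

complementTail : ∀ {n} → Vertex (suc n) → Vertex (suc n)
complementTail (b ∷ xs) = b ∷ map not xs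

complementTail-involutive : ∀ {n} (x : Vertex (suc n)) → complementTail (complementTail x) ≡ x
complementTail-involutive (b ∷ xs) =
  cong (b ∷_) (trans (sym (map-∘ not not xs)) (trans (map-cong not-involutive xs) (map-id xs)))

bit : Bool → ℕ
bit b = if b then 1 else 0

hamming-self : ∀ {N} (x : Vertex N) → hamming x x ≡ 0
hamming-self []       = refl
hamming-self (b ∷ xs) rewrite xor-same b = hamming-self xs

hamming≡0⇒≡ : ∀ {N} {x y : Vertex N} → hamming x y ≡ 0 → x ≡ y
hamming≡0⇒≡ {x = []}         {[]}          _ = refl
hamming≡0⇒≡ {x = true ∷ xs}  {true ∷ ys}  eq = cong (true ∷_) (hamming≡0⇒≡ eq)
hamming≡0⇒≡ {x = false ∷ xs} {false ∷ ys} eq = cong (false ∷_) (hamming≡0⇒≡ eq)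
hamming≡0⇒≡ {x = true ∷ xs}  {false ∷ ys} ()
hamming≡0⇒≡ {x = false ∷ xs} {true ∷ ys}  ()

flip-adjacent : ∀ {N} (x : Vertex N) i → Adj x (flip i x)
flip-adjacent (b ∷ xs) zero    rewrite xor-inverseʳ b = cong suc (hamming-self xs)
flip-adjacent (b ∷ xs) (suc i) rewrite xor-same b     = flip-adjacent xs i

adjacent⇒flip : ∀ {N} (x y : Vertex N) → Adj x y → ∃ λ k → y ≡ flip k x
adjacent⇒flip []         []          ()
adjacent⇒flip (true ∷ xs)  (true ∷ ys)  adj =
  let k , eq = adjacent⇒flip xs ys adj in suc k , cong (true ∷_) eq
adjacent⇒flip (false ∷ xs) (false ∷ ys) adj =
  let k , eq = adjacent⇒flip xs ys adj in suc k , cong (false ∷_) eq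
adjacent⇒flip (true ∷ xs)  (false ∷ ys) adj =
  zero , cong (false ∷_) (sym (hamming≡0⇒≡ (suc-injective adj)))
adjacent⇒flip (false ∷ xs) (true ∷ ys)  adj =
  zero , cong (true ∷_) (sym (hamming≡0⇒≡ (suc-injective adj)))

hamming-flip : ∀ {N} (i : Fin N) x y → hamming (flip i x) (flip i y) ≡ hamming x y
hamming-flip zero    (a ∷ xs) (b ∷ ys) = cong (λ d → bit d + hamming xs ys) (not-xor-not a b)
hamming-flip (suc i) (a ∷ xs) (b ∷ ys) = cong (bit (a xor b) +_) (hamming-flip i xs ys)

hamming-map-not : ∀ {N} (xs ys : Vertex N) → hamming (map not xs) (map not ys) ≡ hamming xs ys
hamming-map-not []       []       = refl
hamming-map-not (a ∷ xs) (b ∷ ys) =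
  cong₂ (λ d h → bit d + h) (not-xor-not a b) (hamming-map-not xs ys)

hamming-update : ∀ {N} (i : Fin N) b c xs ys →
  hamming (xs [ i ]≔ b) (ys [ i ]≔ c) + bit (lookup xs i xor lookup ys i)
    ≡ hamming xs ys + bit (b xor c)
hamming-update zero    b c (x ∷ xs) (y ∷ ys) =
  rearrange (bit (b xor c)) (hamming xs ys) (bit (x xor y))
  where
  rearrange : ∀ p h q → p + h + q ≡ q + h + p
  rearrange = solve-∀
hamming-update (suc i) b c (x ∷ xs) (y ∷ ys) = begin
  bit (x xor y) + hamming (xs [ i ]≔ b) (ys [ i ]≔ c) + bit (lookup xs i xor lookup ys i)
    ≡⟨ +-assoc (bit (x xor y)) _ _ ⟩
  bit (x xor y) + (hamming (xs [ i ]≔ b) (ys [ i ]≔ c) + bit (lookup xs i xor lookup ys i))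
    ≡⟨ cong (bit (x xor y) +_) (hamming-update i b c xs ys) ⟩
  bit (x xor y) + (hamming xs ys + bit (b xor c))
    ≡⟨ +-assoc (bit (x xor y)) _ _ ⟨
  bit (x xor y) + hamming xs ys + bit (b xor c) ∎

hamming-swapHead : ∀ {n} (k : Fin (suc n)) x y → hamming (swapHead k x) (swapHead k y) ≡ hamming x y
hamming-swapHead zero    x        y        = refl
hamming-swapHead (suc k) (b ∷ xs) (c ∷ ys) =
  trans (+-comm (bit (lookup xs k xor lookup ys k)) _)
        (trans (hamming-update k b c xs ys) (+-comm (hamming xs ys) (bit (b xor c))))

preserves-adjacency : ∀ {N} (g : Aut N) x y → Adj x y → Adj (to g x) (to g y)
preserves-adjacency g x y = Equivalence.to (adj-pres g x y)

to-injective : ∀ {N} (g : Aut N) {x y} → to g x ≡ to g y → x ≡ y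
to-injective g {x} {y} eq = trans (sym (from-to g x)) (trans (cong (from g) eq) (from-to g y))

idAut : ∀ {N} → Aut N
idAut = record
  { to = id ; from = id ; to-from = λ _ → refl ; from-to = λ _ → refl ; adj-pres = λ _ _ → ⇔-id _ }

compAut : ∀ {N} → Aut N → Aut N → Aut N
compAut g h = record
  { to       = to g ∘ to h
  ; from     = from h ∘ from g
  ; to-from  = λ y → trans (cong (to g) (to-from h (from g y))) (to-from g y)
  ; from-to  = λ x → trans (cong (from h) (from-to g (to h x))) (from-to h x)
  ; adj-pres = λ x y → adj-pres g (to h x) (to h y) ⇔-∘ adj-pres h x y
  }

invAut : ∀ {N} → Aut N → Aut N
invAut g = record
  { to       = from g
  ; from     = to g
  ; to-from  = from-to g
  ; from-to  = to-from g
  ; adj-pres = λ x y → subst₂ (λ u v → Adj u v ⇔ Adj (from g x) (from g y))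
                               (to-from g x) (to-from g y) (⇔-sym (adj-pres g (from g x) (from g y)))
  }

involutionAut : ∀ {N} (f : Vertex N → Vertex N) → (∀ x → f (f x) ≡ x) →
                (∀ x y → hamming (f x) (f y) ≡ hamming x y) → Aut N
involutionAut f involutive isometry = record
  { to       = f
  ; from     = f
  ; to-from  = involutive
  ; from-to  = involutive
  ; adj-pres = λ x y → mk⇔ (trans (isometry x y)) (trans (sym (isometry x y)))
  }

flipAut : ∀ {N} → Fin N → Aut N
flipAut i = involutionAut (flip i) (flip-involutive i) (hamming-flip i)

swapHeadAut : ∀ {n} → Fin (suc n) → Aut (suc n)
swapHeadAut k = involutionAut (swapHead k) (swapHead-involutive k) (hamming-swapHead k)

complementTailAut : ∀ {n} → Aut (suc n)
complementTailAut = involutionAut complementTail complementTail-involutive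
  (λ { (a ∷ xs) (b ∷ ys) → cong (bit (a xor b) +_) (hamming-map-not xs ys) })

common-neighbours : ∀ {N} {i j : Fin N} v p → i ≢ j → Adj (flip i v) p → Adj (flip j v) p →
                    p ≡ v ⊎ p ≡ flip i (flip j v)
common-neighbours {i = i} {j} v p i≢j adjᵢ adjⱼ
  with adjacent⇒flip (flip i v) p adjᵢ | adjacent⇒flip (flip j v) p adjⱼ
... | l , refl | m , p≡ with l ≟ i | m ≟ i
...   | yes refl | _        = inj₁ (flip-involutive l v)
...   | no _     | yes refl = inj₂ p≡
...   | no l≢i   | no m≢i   = ⊥-elim (not-≢-self (begin
  not (lookup v i)                  ≡⟨ lookup-flip i v ⟨
  lookup (flip i v) i               ≡⟨ lookup-flip-≢ (l≢i ∘ sym) (flip i v) ⟨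
  lookup (flip l (flip i v)) i      ≡⟨ cong (λ u → lookup u i) p≡ ⟩
  lookup (flip m (flip j v)) i      ≡⟨ lookup-flip-≢ (m≢i ∘ sym) (flip j v) ⟩
  lookup (flip j v) i               ≡⟨ lookup-flip-≢ i≢j v ⟩
  lookup v i                        ∎))

flip-induction : ∀ {N} (P : Vertex N → Set) → P zeros → (∀ x i → P x → P (flip i x)) →
                 ∀ x → P x
flip-induction P p₀ step []           = p₀
flip-induction P p₀ step (false ∷ xs) =
  flip-induction (P ∘ (false ∷_)) p₀ (λ x i → step (false ∷ x) (suc i)) xs
flip-induction P p₀ step (true ∷ xs)  =
  flip-induction (P ∘ (true ∷_)) (step zeros zero p₀) (λ x i → step (true ∷ x) (suc i)) xs

Copies : ∀ {N} → (Vertex N → Vertex N) → Fin N → Fin N → Set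
Copies f j k = ∃ λ c → ∀ x → lookup (f x) k ≡ c xor lookup x j

module _ {N} (g : Aut N) where
  private
    neighbour : ∀ i → ∃ λ k → to g (flip i zeros) ≡ flip k (to g zeros)
    neighbour i = adjacent⇒flip _ _ (preserves-adjacency g _ _ (flip-adjacent zeros i))

    π : Fin N → Fin N
    π = proj₁ ∘ neighbour

    π-injective : ∀ {i j} → π i ≡ π j → i ≡ j
    π-injective {i} {j} πi≡πj = flip-cancelʳ zeros (to-injective g (begin
      to g (flip i zeros)      ≡⟨ proj₂ (neighbour i) ⟩
      flip (π i) (to g zeros)  ≡⟨ cong (λ k → flip k (to g zeros)) πi≡πj ⟩
      flip (π j) (to g zeros)  ≡⟨ proj₂ (neighbour j) ⟨
      to g (flip j zeros)      ∎))

    to-flip : ∀ x i → to g (flip i x) ≡ flip (π i) (to g x)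
    to-flip = flip-induction _ (proj₂ ∘ neighbour) step
      where
      step : ∀ x j → (∀ i → to g (flip i x) ≡ flip (π i) (to g x)) →
             ∀ i → to g (flip i (flip j x)) ≡ flip (π i) (to g (flip j x))
      step x j ih i with i ≟ j
      ... | yes refl = begin
        to g (flip i (flip i x))          ≡⟨ cong (to g) (flip-involutive i x) ⟩
        to g x                            ≡⟨ flip-involutive (π i) (to g x) ⟨
        flip (π i) (flip (π i) (to g x))  ≡⟨ cong (flip (π i)) (ih i) ⟨
        flip (π i) (to g (flip i x))      ∎
      ... | no i≢j
        with common-neighbours (to g x) (to g (flip i (flip j x))) (i≢j ∘ π-injective) adjᵢ adjⱼ
        where
        adjᵢ : Adj (flip (π i) (to g x)) (to g (flip i (flip j x)))
        adjᵢ = subst (λ u → Adj u (to g (flip i (flip j x)))) (ih i)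
          (preserves-adjacency g (flip i x) (flip i (flip j x))
            (subst (Adj (flip i x)) (flip-comm j i x) (flip-adjacent (flip i x) j)))
        adjⱼ : Adj (flip (π j) (to g x)) (to g (flip i (flip j x)))
        adjⱼ = subst (λ u → Adj u (to g (flip i (flip j x)))) (ih j)
          (preserves-adjacency g (flip j x) (flip i (flip j x)) (flip-adjacent (flip j x) i))
      ...   | inj₂ eq       = trans eq (cong (flip (π i)) (sym (ih j)))
      ...   | inj₁ collapse = ⊥-elim (flip-flip-≢ i≢j x (to-injective g collapse))

    copies : ∀ j → Copies (to g) j (π j)
    copies j = c , flip-induction _ base step
      where
      c : Bool
      c = lookup (to g zeros) (π j)
      base : lookup (to g zeros) (π j) ≡ c xor lookup zeros j
      base = sym (trans (cong (c xor_) (lookup-replicate j false)) (xor-identityʳ c))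
      step : ∀ x l → lookup (to g x) (π j) ≡ c xor lookup x j →
             lookup (to g (flip l x)) (π j) ≡ c xor lookup (flip l x) j
      step x l ih with l ≟ j
      ... | yes refl = begin
        lookup (to g (flip l x)) (π l)      ≡⟨ cong (λ u → lookup u (π l)) (to-flip x l) ⟩
        lookup (flip (π l) (to g x)) (π l)  ≡⟨ lookup-flip (π l) (to g x) ⟩
        not (lookup (to g x) (π l))         ≡⟨ cong not ih ⟩
        not (c xor lookup x l)              ≡⟨ not-distribʳ-xor c _ ⟩
        c xor not (lookup x l)              ≡⟨ cong (c xor_) (lookup-flip l x) ⟨
        c xor lookup (flip l x) l           ∎
      ... | no l≢j = begin
        lookup (to g (flip l x)) (π j)      ≡⟨ cong (λ u → lookup u (π j)) (to-flip x l) ⟩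
        lookup (flip (π l) (to g x)) (π j)
          ≡⟨ lookup-flip-≢ (l≢j ∘ sym ∘ π-injective) (to g x) ⟩
        lookup (to g x) (π j)               ≡⟨ ih ⟩
        c xor lookup x j                    ≡⟨ cong (c xor_) (lookup-flip-≢ (l≢j ∘ sym) x) ⟨
        c xor lookup (flip l x) j           ∎

  aut-copies : ∀ j → ∃ λ k → Copies (to g) j k
  aut-copies j = π j , copies j

copies-inverse : ∀ {N} (g : Aut N) {j k} → Copies (to g) j k → Copies (from g) k j
copies-inverse g {j} {k} (c , copy) = c , λ z → begin
  lookup (from g z) j                      ≡⟨ xor-cancelˡ c _ ⟨
  c xor (c xor lookup (from g z) j)        ≡⟨ cong (c xor_) (copy (from g z)) ⟨
  c xor lookup (to g (from g z)) k         ≡⟨ cong (λ u → c xor lookup u k) (to-from g z) ⟩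
  c xor lookup z k                         ∎

aut-copied : ∀ {N} (g : Aut N) k → ∃ λ j → Copies (to g) j k
aut-copied g k = let j , copy = aut-copies (invAut g) k in j , copies-inverse (invAut g) copy

2^suc : ∀ n → 2 ^ suc n ≡ 2 ^ n + 2 ^ n
2^suc n = cong (2 ^ n +_) (+-identityʳ (2 ^ n))

m+o+n≡o+[m+n] : ∀ m n o → m + o + n ≡ o + (m + n)
m+o+n≡o+[m+n] = solve-∀

<-shift : ∀ c {x m k} → k ≡ c + m → c + x < k ⇔ x < m
<-shift c refl = mk⇔ (+-cancelˡ-< c _ _) (+-monoʳ-< c)

val-bound : ∀ {N} (x : Vertex N) → val x < 2 ^ N
val-bound []                   = s≤s z≤n
val-bound {suc N} (false ∷ xs) = <-≤-trans (val-bound xs) (m≤m+n _ _)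
val-bound {suc N} (true ∷ xs)  =
  subst (2 ^ N + val xs <_) (sym (2^suc N)) (+-monoʳ-< (2 ^ N) (val-bound xs))

val-zeros : ∀ {N} → val (zeros {N}) ≡ 0
val-zeros {zero}  = refl
val-zeros {suc N} = val-zeros {N}

val-ones : ∀ {N} → suc (val (ones {N})) ≡ 2 ^ N
val-ones {zero}  = refl
val-ones {suc N} = begin
  suc (2 ^ N + val (ones {N}))  ≡⟨ +-suc (2 ^ N) _ ⟨
  2 ^ N + suc (val (ones {N}))  ≡⟨ cong (2 ^ N +_) (val-ones {N}) ⟩
  2 ^ N + 2 ^ N                 ≡⟨ 2^suc N ⟨
  2 ^ suc N                     ∎

val-complement : ∀ {N} (xs : Vertex N) → suc (val (map not xs) + val xs) ≡ 2 ^ N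
val-complement []                   = refl
val-complement {suc N} (false ∷ xs) = begin
  suc (2 ^ N + val (map not xs) + val xs)  ≡⟨ shuffle (2 ^ N) (val (map not xs)) (val xs) ⟩
  2 ^ N + suc (val (map not xs) + val xs)  ≡⟨ cong (2 ^ N +_) (val-complement xs) ⟩
  2 ^ N + 2 ^ N                            ≡⟨ 2^suc N ⟨
  2 ^ suc N                                ∎
  where
  shuffle : ∀ p c v → suc (p + c + v) ≡ p + suc (c + v)
  shuffle = solve-∀
val-complement {suc N} (true ∷ xs)  = begin
  suc (val (map not xs) + (2 ^ N + val xs))  ≡⟨ shuffle (2 ^ N) (val (map not xs)) (val xs) ⟩
  2 ^ N + suc (val (map not xs) + val xs)    ≡⟨ cong (2 ^ N +_) (val-complement xs) ⟩
  2 ^ N + 2 ^ N                              ≡⟨ 2^suc N ⟨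
  2 ^ suc N                                  ∎
  where
  shuffle : ∀ p c v → suc (c + (p + v)) ≡ p + suc (c + v)
  shuffle = solve-∀

head-false⇒< : ∀ {n} (u : Vertex (suc n)) → lookup u zero ≡ false → val u < 2 ^ n
head-false⇒< (false ∷ w) refl = val-bound w

head-true⇒≮ : ∀ {n} (u : Vertex (suc n)) → lookup u zero ≡ true → ¬ val u < 2 ^ n
head-true⇒≮ {n} (true ∷ w) refl = m+n≮m (2 ^ n) (val w)

head-false⇒∈ : ∀ {n} a (u : Vertex (suc n)) → lookup u zero ≡ false → InI (a + 2 ^ n) u
head-false⇒∈ {n} a u u₀ = <-≤-trans (head-false⇒< u u₀) (m≤n+m (2 ^ n) a)

<⇒head-false : ∀ {n} (u : Vertex (suc n)) → val u < 2 ^ n → lookup u zero ≡ false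
<⇒head-false (false ∷ w) _ = refl
<⇒head-false {n} (true ∷ w) u< = contradiction u< (m+n≮m (2 ^ n) (val w))

-- Inverse of val on [0, 2 ^ N).
vertex : ∀ {N} → ℕ → Vertex N
vertex {zero}  t = []
vertex {suc N} t with t <? 2 ^ N
... | yes _ = false ∷ vertex t
... | no _  = true ∷ vertex (t ∸ 2 ^ N)

val-vertex : ∀ {N} t → t < 2 ^ N → val (vertex {N} t) ≡ t
val-vertex {zero}  zero    _         = refl
val-vertex {zero}  (suc t) (s≤s ())
val-vertex {suc N} t       t< with t <? 2 ^ N
... | yes t<half = val-vertex {N} t t<half
... | no  t≮half = trans (cong (2 ^ N +_) (val-vertex {N} (t ∸ 2 ^ N) rest<)) t≡
  where
  t≡ : 2 ^ N + (t ∸ 2 ^ N) ≡ t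
  t≡ = m+[n∸m]≡n (≮⇒≥ t≮half)
  rest< : t ∸ 2 ^ N < 2 ^ N
  rest< = Equivalence.to (<-shift (2 ^ N) (2^suc N)) (subst (_< 2 ^ suc N) (sym t≡) t<)

vertex-val : ∀ {N} (x : Vertex N) → vertex (val x) ≡ x
vertex-val []                   = refl
vertex-val {suc N} (false ∷ xs) with val xs <? 2 ^ N
... | yes _  = cong (false ∷_) (vertex-val xs)
... | no  x≮ = contradiction (val-bound xs) x≮
vertex-val {suc N} (true ∷ xs)  with 2 ^ N + val xs <? 2 ^ N
... | yes x< = contradiction x< (m+n≮m (2 ^ N) (val xs))
... | no  _  = cong (true ∷_) (trans (cong (vertex {N}) (m+n∸m≡n (2 ^ N) (val xs))) (vertex-val xs))

injective⇒surjective : ∀ {m} {f : Fin m → Fin m} → Injective _≡_ _≡_ f →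
                       ∀ y → ∃ λ x → f x ≡ y
injective⇒surjective {suc m} {f} f-injective y with any? (λ x → f x ≟ y)
... | yes hit  = hit
... | no  miss = contradiction (injective⇒≤ f′-injective) 1+n≰n
  where
  y≢f : ∀ x → y ≢ f x
  y≢f x y≡fx = miss (x , sym y≡fx)
  f′ : Fin (suc m) → Fin m
  f′ x = punchOut (y≢f x)
  f′-injective : Injective _≡_ _≡_ f′
  f′-injective {x} {x′} eq = f-injective (punchOut-injective (y≢f x) (y≢f x′) eq)

module _ (m : ℕ) (F : ℕ → ℕ) (onto : ∀ t → t < m → ∃ λ i → i < m × F i ≡ t) where
  private
    R : Fin m → Fin m
    R t = fromℕ< (proj₁ (proj₂ (onto (toℕ t) (toℕ<n t))))

    F∘R : ∀ t → F (toℕ (R t)) ≡ toℕ t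
    F∘R t = trans (cong F (toℕ-fromℕ< _)) (proj₂ (proj₂ (onto (toℕ t) (toℕ<n t))))

    R-injective : Injective _≡_ _≡_ R
    R-injective {t} {t′} eq =
      toℕ-injective (trans (sym (F∘R t)) (trans (cong (F ∘ toℕ) eq) (F∘R t′)))

    R-hits : ∀ {i} → i < m → ∃ λ t → toℕ (R t) ≡ i
    R-hits i<m = let t , Rt≡i = injective⇒surjective R-injective (fromℕ< i<m)
                 in t , trans (cong toℕ Rt≡i) (toℕ-fromℕ< i<m)

  -- A right inverse of F on Fin m is injective, hence onto, so F itself is injective.
  onto⇒injective : ∀ {i j} → i < m → j < m → F i ≡ F j → i ≡ j
  onto⇒injective i<m j<m Fi≡Fj with R-hits i<m | R-hits j<m
  ... | t , refl | t′ , refl =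
    cong (toℕ ∘ R) (toℕ-injective (trans (sym (F∘R t)) (trans Fi≡Fj (F∘R t′))))

-- f₁⁻¹(I_a) ∪ f₂⁻¹(I_b) = I_{a+b}: Fit, stated for the inverse automorphisms.
record Cover {N} (a b : ℕ) (f₁ f₂ : Aut N) : Set where
  constructor mkCover
  field covers : ∀ y → (InI a (to f₁ y) ⊎ InI b (to f₂ y)) ⇔ InI (a + b) y

image⇔ : ∀ {N} (g : Aut N) k y → InImage g k y ⇔ InI k (from g y)
image⇔ g k y = mk⇔ (λ { (x , x∈ , refl) → subst (InI k) (sym (from-to g x)) x∈ })
                   (λ y∈ → from g y , y∈ , to-from g y)

fit⇒cover : ∀ {N a b} → Fit N a b → ∃₂ (Cover a b)
fit⇒cover {a = a} {b} (g₁ , g₂ , fit) =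
  invAut g₁ , invAut g₂ , mkCover λ y →
    fit y ⇔-∘ ⇔-sym (image⇔ g₁ a y ⊎-⇔ image⇔ g₂ b y)

cover⇒fit : ∀ {N a b} {f₁ f₂ : Aut N} → Cover a b f₁ f₂ → Fit N a b
cover⇒fit {a = a} {b} {f₁} {f₂} (mkCover cover) =
  invAut f₁ , invAut f₂ , λ y →
    cover y ⇔-∘ (image⇔ (invAut f₁) a y ⊎-⇔ image⇔ (invAut f₂) b y)

fit-comm : ∀ {N a b} → Fit N a b ⇔ Fit N b a
fit-comm = mk⇔ swap-fit swap-fit
  where
  swap-fit : ∀ {N a b} → Fit N a b → Fit N b a
  swap-fit {a = a} {b} (g₁ , g₂ , fit) = g₂ , g₁ , λ y →
    subst (λ m → (InImage g₂ b y ⊎ InImage g₁ a y) ⇔ InI m y) (+-comm a b)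
          (fit y ⇔-∘ mk⇔ swap swap)

module _ {N a b} {f₁ f₂ : Aut N} (a+b≤ : a + b ≤ 2 ^ N) (C : Cover a b f₁ f₂) where
  open Cover C renaming (covers to cover)

  private
    -- Enumerates f₁⁻¹(I_a) on [0, a) and f₂⁻¹(I_b) on [a, a + b), by value.
    enumerate : ℕ → ℕ
    enumerate t with t <? a
    ... | yes _ = val (from f₁ (vertex t))
    ... | no _  = val (from f₂ (vertex (t ∸ a)))

    enumerate₁ : ∀ y → InI a (to f₁ y) → enumerate (val (to f₁ y)) ≡ val y
    enumerate₁ y y∈ with val (to f₁ y) <? a
    ... | yes _ = cong val (trans (cong (from f₁) (vertex-val (to f₁ y))) (from-to f₁ y))
    ... | no y∉ = contradiction y∈ y∉

    enumerate₂ : ∀ y → enumerate (a + val (to f₂ y)) ≡ val y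
    enumerate₂ y with a + val (to f₂ y) <? a
    ... | yes y< = contradiction y< (m+n≮m a _)
    ... | no _   = cong val (trans (cong (from f₂ ∘ vertex) (m+n∸m≡n a _))
                                   (trans (cong (from f₂) (vertex-val (to f₂ y))) (from-to f₂ y)))

    enumerate-onto : ∀ t → t < a + b → ∃ λ i → i < a + b × enumerate i ≡ t
    enumerate-onto t t< = hit (Equivalence.from (cover (vertex t)) (subst (_< a + b) (sym val-t) t<))
      where
      val-t : val (vertex {N} t) ≡ t
      val-t = val-vertex {N} t (<-≤-trans t< a+b≤)
      hit : InI a (to f₁ (vertex t)) ⊎ InI b (to f₂ (vertex t)) →
            ∃ λ i → i < a + b × enumerate i ≡ t
      hit (inj₁ y∈) = _ , <-≤-trans y∈ (m≤m+n a b) , trans (enumerate₁ _ y∈) val-t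
      hit (inj₂ y∈) = _ , +-monoʳ-< a y∈ , trans (enumerate₂ _) val-t

  cover-disjoint : ∀ y → InI a (to f₁ y) → InI b (to f₂ y) → ⊥
  cover-disjoint y y∈₁ y∈₂ = m+n≮m a _ (subst (_< a) same-index y∈₁)
    where
    same-index : val (to f₁ y) ≡ a + val (to f₂ y)
    same-index = onto⇒injective (a + b) enumerate enumerate-onto
      (<-≤-trans y∈₁ (m≤m+n a b)) (+-monoʳ-< a y∈₂)
      (trans (enumerate₁ y y∈₁) (sym (enumerate₂ y)))

cover-postcompose : ∀ {N a b} {f₁ f₂ : Aut N} (σ : Aut N) →
                    (∀ u → InI a (to σ u) ⇔ InI a u) →
                    Cover a b f₁ f₂ → Cover a b (compAut σ f₁) f₂
cover-postcompose {f₁ = f₁} σ σ-preserves (mkCover cover) =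
  mkCover λ y → cover y ⇔-∘ (σ-preserves (to f₁ y) ⊎-⇔ ⇔-id _)

cover-precompose : ∀ {N a b} {f₁ f₂ : Aut N} (σ : Aut N) →
                   (∀ y → InI (a + b) (to σ y) ⇔ InI (a + b) y) →
                   Cover a b f₁ f₂ → Cover a b (compAut f₁ σ) (compAut f₂ σ)
cover-precompose σ σ-preserves (mkCover cover) = mkCover λ y → σ-preserves y ⇔-∘ cover (to σ y)

involution-preserves : ∀ {N} {P : Vertex N → Set} {σ : Vertex N → Vertex N} →
                       (∀ u → σ (σ u) ≡ u) → (∀ u → P u → σ u ≡ u) →
                       ∀ u → P (σ u) ⇔ P u
involution-preserves {P = P} {σ} involutive fixes u = mk⇔
  (λ Pσu → subst P (trans (sym (fixes (σ u) Pσu)) (involutive u)) Pσu)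
  (λ Pu → subst P (sym (fixes u Pu)) Pu)

swapHead-preserves : ∀ {n m} (k : Fin (suc n)) → 2 ^ n ≤ m →
                     (∀ z → lookup z k ≡ false → InI m z) →
                     ∀ y → InI m (swapHead k y) ⇔ InI m y
swapHead-preserves {n} {m} k 2ⁿ≤m k-false⇒∈ y =
  mk⇔ (subst (InI m) (swapHead-involutive k y) ∘ into (swapHead k y)) (into y)
  where
  into : ∀ y → InI m y → InI m (swapHead k y)
  into y y∈ with lookup y k in yₖ | lookup y zero in y₀
  ... | false | _     =
    <-≤-trans (head-false⇒< (swapHead k y) (trans (lookup-swapHead-zero k y) yₖ)) 2ⁿ≤m
  ... | true  | false = k-false⇒∈ (swapHead k y) (trans (lookup-swapHead k y) y₀)
  ... | true  | true  = subst (InI m) (sym (swapHead-id k y (trans y₀ (sym yₖ)))) y∈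

HeadPreserving : ∀ {n} → Aut (suc n) → Set
HeadPreserving f = ∀ x → lookup (to f x) zero ≡ lookup x zero

shiftAut : ∀ {n} → Aut (suc n) → Aut (suc n)
shiftAut f = compAut (flipAut zero) (compAut f (flipAut zero))

flip-head-< : ∀ {n} a (u : Vertex (suc n)) → lookup u zero ≡ false →
              InI (a + 2 ^ n) (flip zero u) ⇔ InI a u
flip-head-< {n} a (false ∷ w) refl = <-shift (2 ^ n) (+-comm a (2 ^ n))

upper-< : ∀ {n} a b (w : Vertex n) → InI (a + 2 ^ n + b) (true ∷ w) ⇔ InI (a + b) w
upper-< {n} a b w = <-shift (2 ^ n) (m+o+n≡o+[m+n] a b (2 ^ n))

cover-lift : ∀ {n a b} {f₁ f₂ : Aut (suc n)} → a + b ≤ 2 ^ n → HeadPreserving f₁ →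
             Cover a b f₁ f₂ → Cover (a + 2 ^ n) b (shiftAut f₁) (compAut f₂ (flipAut zero))
cover-lift {n} {a} {b} {f₁} {f₂} a+b≤2ⁿ preserving (mkCover cover) = mkCover lifted
  where
  lifted : ∀ y → (InI (a + 2 ^ n) (flip zero (to f₁ (flip zero y))) ⊎ InI b (to f₂ (flip zero y)))
                   ⇔ InI (a + 2 ^ n + b) y
  lifted (false ∷ w) = mk⇔
    (λ _ → <-≤-trans (val-bound w) (≤-trans (m≤n+m (2 ^ n) a) (m≤m+n _ b)))
    (λ _ → inj₁ (head-false⇒∈ a (flip zero u)
                  (trans (lookup-flip zero u) (cong not (preserving (true ∷ w))))))
    where
    u : Vertex (suc n)
    u = to f₁ (true ∷ w)
  lifted (true ∷ w) =
    ⇔-sym (upper-< a b w) ⇔-∘ (cover (false ∷ w) ⇔-∘ (shifted ⊎-⇔ ⇔-id _))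
    where
    shifted : InI (a + 2 ^ n) (flip zero (to f₁ (false ∷ w))) ⇔ InI a (to f₁ (false ∷ w))
    shifted = flip-head-< a (to f₁ (false ∷ w)) (preserving (false ∷ w))

cover-lower : ∀ {n a b} {f₁ f₂ : Aut (suc n)} → a + b ≤ 2 ^ n → HeadPreserving f₁ →
              Cover (a + 2 ^ n) b f₁ f₂ → Cover a b (shiftAut f₁) (compAut f₂ (flipAut zero))
cover-lower {n} {a} {b} {f₁} {f₂} a+b≤2ⁿ preserving C@(mkCover cover) = mkCover lowered
  where
  total≤ : a + 2 ^ n + b ≤ 2 ^ suc n
  total≤ = subst₂ _≤_ (sym (m+o+n≡o+[m+n] a b (2 ^ n))) (sym (2^suc n))
                      (+-monoʳ-≤ (2 ^ n) a+b≤2ⁿ)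
  lowered : ∀ y → (InI a (flip zero (to f₁ (flip zero y))) ⊎ InI b (to f₂ (flip zero y)))
                    ⇔ InI (a + b) y
  lowered (false ∷ w) = upper-< a b w ⇔-∘ (cover (true ∷ w) ⇔-∘ (shifted ⊎-⇔ ⇔-id _))
    where
    u : Vertex (suc n)
    u = to f₁ (true ∷ w)
    shifted : InI a (flip zero u) ⇔ InI (a + 2 ^ n) u
    shifted = subst (λ v → InI a (flip zero u) ⇔ InI (a + 2 ^ n) v) (flip-involutive zero u)
      (⇔-sym (flip-head-< a (flip zero u)
                (trans (lookup-flip zero u) (cong not (preserving (true ∷ w))))))
  lowered (true ∷ w) = mk⇔
    (λ { (inj₁ y∈) → ⊥-elim (head-true⇒≮ (flip zero u) flipped-head
                                (<-≤-trans y∈ (≤-trans (m≤m+n a b) a+b≤2ⁿ)))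
       ; (inj₂ y∈) → ⊥-elim (cover-disjoint total≤ C (false ∷ w)
                                (head-false⇒∈ a u (preserving (false ∷ w))) y∈) })
    (λ y∈ → ⊥-elim (head-true⇒≮ (true ∷ w) refl (<-≤-trans y∈ a+b≤2ⁿ)))
    where
    u : Vertex (suc n)
    u = to f₁ (false ∷ w)
    flipped-head : lookup (flip zero u) zero ≡ true
    flipped-head = trans (lookup-flip zero u) (cong not (preserving (false ∷ w)))

cover-half : ∀ {n a b} → a + b ≡ 2 ^ n → Cover {suc n} a b idAut complementTailAut
cover-half {n} {a} {b} a+b≡2ⁿ = mkCover halves
  where
  upper∉ : ∀ m (v : Vertex n) → m ≤ a + b → ¬ InI m (true ∷ v)
  upper∉ m v m≤ v∈ = head-true⇒≮ (true ∷ v) refl (<-≤-trans v∈ (subst (m ≤_) a+b≡2ⁿ m≤))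
  halves : ∀ y → (InI a y ⊎ InI b (complementTail y)) ⇔ InI (a + b) y
  halves (false ∷ w) = mk⇔
    (λ _ → subst (val w <_) (sym a+b≡2ⁿ) (val-bound w))
    (λ _ → split (val w <? a))
    where
    split : Dec (val w < a) → InI a (false ∷ w) ⊎ InI b (complementTail (false ∷ w))
    split (yes w<a) = inj₁ w<a
    split (no  w≮a) = inj₂ (+-cancelʳ-< a _ b (subst (val (map not w) + a <_) total
                                                (s≤s (+-monoʳ-≤ (val (map not w)) (≮⇒≥ w≮a)))))
      where
      total : suc (val (map not w) + val w) ≡ b + a
      total = trans (val-complement w) (trans (sym a+b≡2ⁿ) (+-comm a b))
  halves (true ∷ w) = mk⇔
    (λ { (inj₁ y∈) → ⊥-elim (upper∉ a w (m≤m+n a b) y∈)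
       ; (inj₂ y∈) → ⊥-elim (upper∉ b (map not w) (m≤n+m b a) y∈) })
    (λ y∈ → ⊥-elim (upper∉ (a + b) w ≤-refl y∈))

fit-half : ∀ {n a b} → a + b ≡ 2 ^ n → Fit (suc n) a b
fit-half a+b≡2ⁿ = cover⇒fit (cover-half a+b≡2ⁿ)

fit-lift : ∀ {n a b} → 1 ≤ a → a + b ≤ 2 ^ n → Fit (suc n) a b → Fit (suc n) (a + 2 ^ n) b
fit-lift {n} {a} {b} 1≤a a+b≤2ⁿ fit with fit⇒cover fit
... | f₁ , f₂ , C@(mkCover cover) with aut-copies f₁ zero
... | j , c , copy =
  cover⇒fit (cover-lift a+b≤2ⁿ preserving (cover-postcompose (swapHeadAut j) fixes C))
  where
  preimage-head : ∀ u → InI a u → lookup (from f₁ u) zero ≡ false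
  preimage-head u u∈ = <⇒head-false (from f₁ u)
    (<-≤-trans (Equivalence.to (cover (from f₁ u)) (inj₁ (subst (InI a) (sym (to-from f₁ u)) u∈)))
               a+b≤2ⁿ)
  coordinate : ∀ u → InI a u → lookup u j ≡ c
  coordinate u u∈ = begin
    lookup u j                     ≡⟨ cong (λ v → lookup v j) (to-from f₁ u) ⟨
    lookup (to f₁ (from f₁ u)) j   ≡⟨ copy (from f₁ u) ⟩
    c xor lookup (from f₁ u) zero  ≡⟨ cong (c xor_) (preimage-head u u∈) ⟩
    c xor false                    ≡⟨ xor-identityʳ c ⟩
    c                              ∎
  c≡false : c ≡ false
  c≡false = trans (sym (coordinate zeros zeros∈)) (lookup-replicate j false)
    where
    zeros∈ : InI a (zeros {suc n})
    zeros∈ = subst (_< a) (sym (val-zeros {suc n})) 1≤a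
  fixes : ∀ u → InI a (swapHead j u) ⇔ InI a u
  fixes = involution-preserves (swapHead-involutive j) λ u u∈ →
    swapHead-id j u (trans (<⇒head-false u (<-≤-trans u∈ (≤-trans (m≤m+n a b) a+b≤2ⁿ)))
                           (sym (trans (coordinate u u∈) c≡false)))
  preserving : HeadPreserving (compAut (swapHeadAut j) f₁)
  preserving x = begin
    lookup (swapHead j (to f₁ x)) zero  ≡⟨ lookup-swapHead-zero j (to f₁ x) ⟩
    lookup (to f₁ x) j                  ≡⟨ copy x ⟩
    c xor lookup x zero                 ≡⟨ cong (_xor lookup x zero) c≡false ⟩
    lookup x zero                       ∎

fit-lower : ∀ {n a b} → a + b ≤ 2 ^ n → Fit (suc n) (a + 2 ^ n) b → Fit (suc n) a b
fit-lower {n} {a} {b} a+b≤2ⁿ fit with m≤n⇒m<n∨m≡n a+b≤2ⁿ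
... | inj₂ a+b≡2ⁿ = fit-half a+b≡2ⁿ
... | inj₁ a+b<2ⁿ with fit⇒cover fit
...   | f₁ , f₂ , C@(mkCover cover) with aut-copied f₁ zero
...     | k , c , copy =
  cover⇒fit (cover-lower a+b≤2ⁿ preserving (cover-precompose (swapHeadAut k) swapped C))
  where
  ones∉ : ¬ InI (a + 2 ^ n + b) (ones {suc n})
  ones∉ ones∈ = <⇒≱ ones∈ (s≤s⁻¹ (subst₂ _<_ (sym (m+o+n≡o+[m+n] a b (2 ^ n)))
                                              (trans (sym (2^suc n)) (sym (val-ones {suc n})))
                                              (+-monoʳ-< (2 ^ n) a+b<2ⁿ)))
  c≡false : c ≡ false
  c≡false = constant-false c copy
    where
    constant-false : ∀ c → (∀ z → lookup (to f₁ z) zero ≡ c xor lookup z k) → c ≡ false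
    constant-false false _     = refl
    constant-false true  copy′ = ⊥-elim (ones∉ (Equivalence.to (cover ones) (inj₁
      (head-false⇒∈ a (to f₁ ones) (trans (copy′ ones) (cong not (lookup-replicate k true)))))))
  k-false⇒∈ : ∀ z → lookup z k ≡ false → InI (a + 2 ^ n + b) z
  k-false⇒∈ z zₖ = Equivalence.to (cover z)
    (inj₁ (head-false⇒∈ a (to f₁ z) (trans (copy z) (cong₂ _xor_ c≡false zₖ))))
  swapped : ∀ y → InI (a + 2 ^ n + b) (swapHead k y) ⇔ InI (a + 2 ^ n + b) y
  swapped = swapHead-preserves k (≤-trans (m≤n+m (2 ^ n) a) (m≤m+n _ b)) k-false⇒∈
  preserving : HeadPreserving (compAut f₁ (swapHeadAut k))
  preserving x = begin
    lookup (to f₁ (swapHead k x)) zero  ≡⟨ copy (swapHead k x) ⟩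
    c xor lookup (swapHead k x) k       ≡⟨ cong₂ _xor_ c≡false (lookup-swapHead k x) ⟩
    lookup x zero                       ∎

fit-+2ⁿ : ∀ {n a b} → 1 ≤ a → a + b ≤ 2 ^ n → Fit (suc n) a b ⇔ Fit (suc n) (a + 2 ^ n) b
fit-+2ⁿ 1≤a a+b≤2ⁿ = mk⇔ (fit-lift 1≤a a+b≤2ⁿ) (fit-lower a+b≤2ⁿ)

mainTheorem5 : (n a b : ℕ) → 1 ≤ n → 1 ≤ a → 1 ≤ b → a + b ≤ 2 ^ n →
    (Fit (suc n) a b ⇔ Fit (suc n) (a + 2 ^ n) b)
      × (Fit (suc n) a b ⇔ Fit (suc n) a (b + 2 ^ n))
mainTheorem5 n a b _ 1≤a 1≤b a+b≤2ⁿ =  -- the argument does not need 1 ≤ n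
  fit-+2ⁿ 1≤a a+b≤2ⁿ ,
  fit-comm ⇔-∘ (fit-+2ⁿ 1≤b (subst (_≤ 2 ^ n) (+-comm a b) a+b≤2ⁿ) ⇔-∘ fit-comm)
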